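{- For every real $R$ with $1<R\le 3/2$ and every $\epsilon>0$, the competitive ratio of the general\&removable online knapsack problem with a buffer of capacity $R$ is at least $\frac{1}{R-1}-\epsilon$.
   Context: Online knapsack problem with a resource buffer: there is a knapsack of capacity $1$ and a buffer of capacity $R\ge 1$. Items $e_1,\dots,e_n$ arrive one by one; each item $e$ has size $0<s(e)\le 1$ and value $v(e)\ge 0$; $s(B),v(B)$ denote sums over a set $B$. A deterministic online algorithm maintains buffer contents $B_0=\emptyset,B_1,\dots,B_n$, with $B_i$ chosen after seeing only $e_1,\dots,e_i$, $B_i\subseteq B_{i-1}\cup\{e_i\}$ and $s(B_i)\le R$ (removable setting). $\mathrm{ALG}(I)=\max\{v(B)\mid B\subseteq B_n,\ s(B)\le 1\}$, $\mathrm{OPT}(I)=\max\{v(B)\mid B\subseteq\{e_1,\dots,e_n\},\ s(B)\le 1\}$. "General" means values are arbitrary. The competitive ratio of an algorithm is $\sup_I \mathrm{OPT}(I)/\mathrm{ALG}(I)$ (with $a/0=\infty$ for $a>0$), and the competitive ratio of the problem is the infimum of this over all deterministic online algorithms.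
   Formalization: The buffer capacity R and the parameter ε range over the rationals rather than the reals, and the sizes and values of the items are taken in the rationals as well. -}

module Defs where

open import Data.Nat using (ℕ; zero; suc)
open import Data.Vec using (Vec; []; _∷_; _∷ʳ_)
open import Data.Fin.Subset using (Subset; _⊆_; inside; outside)
open import Data.Rational using (ℚ; 0ℚ; 1ℚ; _<_; _≤_; _+_; _*_; 1/_; Positive; positive)
open import Data.Rational.Properties using (_<?_; pos⇒nonZero)
open import Data.Product using (Σ; _×_; _,_)
open import Data.Sum using (_⊎_)
open import Relation.Binary.PropositionalEquality using (_≡_)
open import Relation.Nullary using (yes; no)

record Item : Set where
  field
    size  : ℚ
    value : ℚ
    size-pos : 0ℚ < size
    size≤1   : size ≤ 1ℚ
    value≥0  : 0ℚ ≤ value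
open Item public

sumOver : ∀ {n} → (Item → ℚ) → Vec Item n → Subset n → ℚ
sumOver f []       []            = 0ℚ
sumOver f (x ∷ xs) (inside ∷ B)  = f x + sumOver f xs B
sumOver f (x ∷ xs) (outside ∷ B) = sumOver f xs B

s[_] : ∀ {n} → Vec Item n → Subset n → ℚ
s[ xs ] B = sumOver size xs B

v[_] : ∀ {n} → Vec Item n → Subset n → ℚ
v[ xs ] B = sumOver value xs B

IsMaxPacking : ∀ {n} → Vec Item n → Subset n → ℚ → Set
IsMaxPacking xs A m =
  Σ (Subset _) (λ B → B ⊆ A × s[ xs ] B ≤ 1ℚ × v[ xs ] B ≡ m)
  × (∀ B → B ⊆ A → s[ xs ] B ≤ 1ℚ → v[ xs ] B ≤ m)

-- Deterministic online algorithm (removable setting) with buffer capacity R: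
-- the buffer B_i is a function of the prefix e_1..e_i (indices into the prefix).
record OnlineAlg (R : ℚ) : Set where
  field
    buffer   : ∀ {n} → Vec Item n → Subset n
    buffer-⊆ : ∀ {n} (xs : Vec Item n) (e : Item) →
               buffer (xs ∷ʳ e) ⊆ (buffer xs ∷ʳ inside)
    buffer-cap : ∀ {n} (xs : Vec Item n) → s[ xs ] (buffer xs) ≤ R
open OnlineAlg public

-- OPT/ALG > t, with the convention a/0 = ∞ for a > 0.
RatioExceeds : (alg opt t : ℚ) → Set
RatioExceeds alg opt t = (alg ≡ 0ℚ × 0ℚ < opt) ⊎ (0ℚ < alg × t * alg < opt)

-- 1/q for q > 0 (and 0 otherwise; only used for positive q).
recip : ℚ → ℚ
recip q with 0ℚ <? q
... | yes p = (1/ q) {{pos⇒nonZero q {{positive p}}}}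
... | no _  = 0ℚ

{-# OPTIONS --safe #-}
module Submission where

open import Data.Nat.Base as ℕ using (ℕ; zero; suc; s≤s; z≤n)
import Data.Nat.Properties as ℕ
open import Data.Nat.Tactic.RingSolver using (solve-∀)
open import Data.Product using (Σ; ∃-syntax; _×_; _,_)
open import Data.Sum using (_⊎_; inj₁; inj₂; [_,_]′)
open import Relation.Binary.PropositionalEquality using (_≡_; refl; sym; trans; cong; cong₂; subst; subst₂)
open import Relation.Nullary using (¬_; Dec; yes; no)
open import Relation.Nullary.Decidable using (_×-dec_)
open import Data.Empty using (⊥-elim)

-- The adversary presents one large item (size 1, value V) followed by small items of
-- size 1/q and values 0, 1, 2, …, and stops right after the step at which the
-- algorithm discards the large item (or after a fixed number of steps). Beside the
-- large item the buffer has room for only m = (R − 1) q small items, so once it is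
-- discarded the buffer holds at most m + 1 of them, each worth less than the current
-- step. If the large item goes early, OPT ≥ V dwarfs the buffer; if it goes late, at
-- step q + j, or is never discarded, OPT packs the q newest small items, worth at
-- least q j, while ALG is at most V or (m + 1)(q + j). As q / m = 1 / (R − 1), the
-- ratio approaches 1 / (R − 1) when q and j grow.

-- R − 1 = a / b and ε ≥ 1 / E; small items have size 1 / q with q = b Q.
module Parameters (a′ b′ E′ : ℕ) where
  open import Data.Nat.Base using (_+_; _*_; _≤_; _<_)
  open import Data.Nat.Properties
  open ≤-Reasoning

  a b E Q′ Q q′ q m P : ℕ
  a = suc a′
  b = suc b′
  E = suc E′
  Q′ = 2 * (b * E)
  Q = suc Q′
  q′ = Q′ + b′ * Q
  q = suc q′
  m = a * Q
  P = suc m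

  -- y / x > b / a − 1 / E, with denominators cleared.
  OptBeats : ℕ → ℕ → Set
  OptBeats x y = b * E * x < a * (E * y + x)

  capacity : ∀ c → (q + c) * b ≤ (b + a) * q → c ≤ m
  capacity c h =
    *-cancelʳ-≤ c m b (+-cancelˡ-≤ (q * b) (c * b) (m * b) (subst₂ _≤_ (lhs c) (rhs a′ b′ Q′) h))
    where
    lhs : ∀ c → (q + c) * b ≡ q * b + c * b
    lhs c = *-distribʳ-+ b q c
    rhs : ∀ a′ b′ Q′ → (suc b′ + suc a′) * (suc b′ * suc Q′)
                       ≡ suc b′ * suc Q′ * suc b′ + suc a′ * suc Q′ * suc b′
    rhs = solve-∀

  0<q* : ∀ {j} → 0 < j → 0 < q * j
  0<q* 0<j = <-≤-trans (s≤s z≤n) (*-monoʳ-≤ q 0<j)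

  -- Kept opaque: unfolding these constants makes conversion checking expand huge normal forms.
  opaque
    J K V jN : ℕ
    J = P * q
    K = q + J
    V = suc (b * E * (P * K))
    jN = J + suc (b * V)

    0<V : 0 < V
    0<V = s≤s z≤n

    J≤jN : J ≤ jN
    J≤jN = m≤m+n J (suc (b * V))

    bV<jN : b * V < jN
    bV<jN = <-≤-trans (n<1+n (b * V)) (m≤n+m (suc (b * V)) J)

    J≤⇒0< : ∀ {j} → J ≤ j → 0 < j
    J≤⇒0< = <-≤-trans (s≤s z≤n)

    beyond-K : ∀ {k} → K < k → ∃[ j ] J ≤ j × q + j ≡ k
    beyond-K K<k with m≤n⇒∃[o]m+o≡n (≤-trans (m≤m+n q J) (<⇒≤ K<k))
    ... | j , refl = j , <⇒≤ (+-cancelˡ-< q J j K<k) , refl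

    optBeats-early : ∀ {k} → k ≤ K → OptBeats (P * k) V
    optBeats-early {k} k≤K = begin-strict
      b * E * (P * k)    ≤⟨ *-monoʳ-≤ (b * E) (*-monoʳ-≤ P k≤K) ⟩
      b * E * (P * K)    <⟨ n<1+n _ ⟩
      V                  ≤⟨ m≤n*m V E ⟩
      E * V              ≤⟨ m≤m+n (E * V) (P * k) ⟩
      E * V + P * k      ≤⟨ m≤n*m _ a ⟩
      a * (E * V + P * k) ∎

    optBeats-late : ∀ {j} → J ≤ j → OptBeats (P * (q + j)) (q * j)
    optBeats-late {j} J≤j = begin-strict
      b * E * (P * (q + j))                              ≡⟨ expand a′ b′ E′ Q′ j ⟩
      b * E * (P * q) + b * E * j + a * (E * (q * j))    ≤⟨ +-monoˡ-≤ _ (+-monoˡ-≤ _ (*-monoʳ-≤ (b * E) J≤j)) ⟩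
      b * E * j + b * E * j + a * (E * (q * j))          <⟨ +-monoˡ-< _ twice< ⟩
      a * (P * (q + j)) + a * (E * (q * j))              ≡⟨ collect a (E * (q * j)) (P * (q + j)) ⟩
      a * (E * (q * j) + P * (q + j))                    ∎
      where
      expand : ∀ a′ b′ E′ Q′ j →
        suc b′ * suc E′ * (suc (suc a′ * suc Q′) * (suc b′ * suc Q′ + j))
          ≡ suc b′ * suc E′ * (suc (suc a′ * suc Q′) * (suc b′ * suc Q′)) + suc b′ * suc E′ * j
            + suc a′ * (suc E′ * (suc b′ * suc Q′ * j))
      expand = solve-∀
      collect : ∀ a y x → a * x + a * y ≡ a * (y + x)
      collect = solve-∀
      twice< : b * E * j + b * E * j < a * (P * (q + j))
      twice< = begin-strict
        b * E * j + b * E * j   ≡⟨ double (b * E) j ⟩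
        Q′ * j                  ≤⟨ *-monoˡ-≤ j (n≤1+n Q′) ⟩
        Q * j                   ≤⟨ *-monoˡ-≤ j (≤-trans (m≤n*m Q a) (n≤1+n m)) ⟩
        P * j                   <⟨ *-monoʳ-< P (m<n+m j {q} (s≤s z≤n)) ⟩
        P * (q + j)             ≤⟨ m≤n*m _ a ⟩
        a * (P * (q + j))       ∎
        where
        double : ∀ x j → x * j + x * j ≡ 2 * x * j
        double = solve-∀

    optBeats-large : ∀ {j} → b * V < j → OptBeats V (q * j)
    optBeats-large {j} bV<j = begin-strict
      b * E * V            ≡⟨ swap b E V ⟩
      E * (b * V)          <⟨ *-monoʳ-< E bV<j ⟩
      E * j                ≤⟨ *-monoʳ-≤ E (m≤n*m j q) ⟩
      E * (q * j)          ≤⟨ m≤m+n (E * (q * j)) V ⟩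
      E * (q * j) + V      ≤⟨ m≤n*m _ a ⟩
      a * (E * (q * j) + V) ∎
      where
      swap : ∀ b E V → b * E * V ≡ E * (b * V)
      swap = solve-∀

open import Defs
open import Data.Nat.Coprimality using (1-coprimeTo)
import Data.Nat.Coprimality as Coprime
open import Data.Integer.Base as ℤ using (+_; +[1+_]; -[1+_])
import Data.Integer.Properties as ℤ
open import Data.Rational.Base as ℚ using (ℚ; mkℚ; 0ℚ; 1ℚ; toℚᵘ; _+_; _-_; _*_; _≤_; _<_; _/_)
import Data.Rational.Properties as ℚ
open import Data.Rational.Solver using (module +-*-Solver)
open import Data.Rational.Unnormalised.Base as ℚᵘ using (mkℚᵘ; *≡*; *≤*; *<*) renaming (_≃_ to _≃ᵘ_)
import Data.Rational.Unnormalised.Properties as ℚᵘ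
open import Data.Vec.Base using (Vec; []; _∷_; _∷ʳ_; here)
open import Data.Vec.Relation.Unary.All as All using (All; []; _∷_)
open import Data.Fin.Subset using (Subset; _⊆_; inside; outside; ⊥; ⊤; ∣_∣)
open import Data.Fin.Subset.Properties using (_⊆?_; drop-∷-⊆; ⊆⊤; ⊥⊆; p⊆q⇒∣p∣≤∣q∣; ∣⊥∣≡0)

-- p = n / (1 + d), the denominator convention of ℚᵘ; order and equality of such
-- rationals reduce to cross-multiplied inequalities in ℕ.
infix 4 _≐_/1+_
record _≐_/1+_ (p : ℚ) (n d : ℕ) : Set where
  constructor by-toℚᵘ
  field toℚᵘ-≃ : toℚᵘ p ≃ᵘ mkℚᵘ (+ n) d
open _≐_/1+_

fromℕ : ℕ → ℚ
fromℕ n = mkℚ (+ n) 0 (Coprime.sym (1-coprimeTo n))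

1/1+_ : ℕ → ℚ
1/1+ d = mkℚ (+ 1) d (1-coprimeTo (suc d))

fromℕ-≐ : ∀ n → fromℕ n ≐ n /1+ 0
fromℕ-≐ n = by-toℚᵘ ℚᵘ.≃-refl

1/1+-≐ : ∀ d → 1/1+ d ≐ 1 /1+ d
1/1+-≐ d = by-toℚᵘ ℚᵘ.≃-refl

module _ {m n d e : ℕ} where

  mkℚᵘ-≃ : m ℕ.* suc e ≡ n ℕ.* suc d → mkℚᵘ (+ m) d ≃ᵘ mkℚᵘ (+ n) e
  mkℚᵘ-≃ eq = *≡* (trans (sym (ℤ.pos-* m (suc e))) (trans (cong +_ eq) (ℤ.pos-* n (suc d))))

  ≐-resp : ∀ {p} → p ≐ m /1+ d → m ℕ.* suc e ≡ n ℕ.* suc d → p ≐ n /1+ e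
  ≐-resp (by-toℚᵘ p≃) eq = by-toℚᵘ (ℚᵘ.≃-trans p≃ (mkℚᵘ-≃ eq))

  ≐-mono-≤ : ∀ {p q} → p ≐ m /1+ d → q ≐ n /1+ e → m ℕ.* suc e ℕ.≤ n ℕ.* suc d → p ≤ q
  ≐-mono-≤ (by-toℚᵘ p≃) (by-toℚᵘ q≃) le = ℚ.toℚᵘ-cancel-≤
    (ℚᵘ.≤-respˡ-≃ (ℚᵘ.≃-sym p≃) (ℚᵘ.≤-respʳ-≃ (ℚᵘ.≃-sym q≃)
      (*≤* (subst₂ ℤ._≤_ (ℤ.pos-* m (suc e)) (ℤ.pos-* n (suc d)) (ℤ.+≤+ le)))))

  ≐-mono-< : ∀ {p q} → p ≐ m /1+ d → q ≐ n /1+ e → m ℕ.* suc e ℕ.< n ℕ.* suc d → p < q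
  ≐-mono-< (by-toℚᵘ p≃) (by-toℚᵘ q≃) lt = ℚ.toℚᵘ-cancel-<
    (ℚᵘ.<-respˡ-≃ (ℚᵘ.≃-sym p≃) (ℚᵘ.<-respʳ-≃ (ℚᵘ.≃-sym q≃)
      (*<* (subst₂ ℤ._<_ (ℤ.pos-* m (suc e)) (ℤ.pos-* n (suc d)) (ℤ.+<+ lt)))))

  ≐-cancel-≤ : ∀ {p q} → p ≐ m /1+ d → q ≐ n /1+ e → p ≤ q → m ℕ.* suc e ℕ.≤ n ℕ.* suc d
  ≐-cancel-≤ (by-toℚᵘ p≃) (by-toℚᵘ q≃) p≤q
    with ℚᵘ.≤-respˡ-≃ p≃ (ℚᵘ.≤-respʳ-≃ q≃ (ℚ.toℚᵘ-mono-≤ p≤q))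
  ... | *≤* le with subst₂ ℤ._≤_ (sym (ℤ.pos-* m (suc e))) (sym (ℤ.pos-* n (suc d))) le
  ...   | ℤ.+≤+ le′ = le′

≐-+ : ∀ {p q m n d} → p ≐ m /1+ d → q ≐ n /1+ d → p + q ≐ (m ℕ.+ n) /1+ d
≐-+ {p} {q} {m} {n} {d} (by-toℚᵘ p≃) (by-toℚᵘ q≃) = by-toℚᵘ
  (ℚᵘ.≃-trans (ℚ.toℚᵘ-homo-+ p q) (ℚᵘ.≃-trans (ℚᵘ.+-cong p≃ q≃)
    (ℚᵘ.≃-trans (ℚᵘ.≃-reflexive numerator) (mkℚᵘ-≃ (sameDenominator m n d)))))
  where
  numerator : mkℚᵘ (+ m) d ℚᵘ.+ mkℚᵘ (+ n) d
              ≡ mkℚᵘ (+ (m ℕ.* suc d ℕ.+ n ℕ.* suc d)) (d ℕ.+ d ℕ.* suc d)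
  numerator = cong (λ i → mkℚᵘ i _)
    (sym (trans (ℤ.pos-+ (m ℕ.* suc d) (n ℕ.* suc d)) (cong₂ ℤ._+_ (ℤ.pos-* m (suc d)) (ℤ.pos-* n (suc d)))))
  sameDenominator : ∀ m n d →
    (m ℕ.* suc d ℕ.+ n ℕ.* suc d) ℕ.* suc d ≡ (m ℕ.+ n) ℕ.* suc (d ℕ.+ d ℕ.* suc d)
  sameDenominator = solve-∀

≐-*-fromℕ : ∀ {p m d} n → p ≐ m /1+ d → p * fromℕ n ≐ (m ℕ.* n) /1+ d
≐-*-fromℕ {p} {m} {d} n (by-toℚᵘ p≃) = by-toℚᵘ
  (ℚᵘ.≃-trans (ℚ.toℚᵘ-homo-* p (fromℕ n)) (ℚᵘ.≃-trans (ℚᵘ.*-cong p≃ ℚᵘ.≃-refl)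
    (ℚᵘ.≃-trans (ℚᵘ.≃-reflexive (cong (λ i → mkℚᵘ i _) (sym (ℤ.pos-* m n))))
      (mkℚᵘ-≃ (denominator m n d)))))
  where
  denominator : ∀ m n d → m ℕ.* n ℕ.* suc d ≡ m ℕ.* n ℕ.* suc (d ℕ.* 1)
  denominator = solve-∀

fromℕ-+ : ∀ m n → fromℕ m + fromℕ n ≡ fromℕ (m ℕ.+ n)
fromℕ-+ m n = ℚ.toℚᵘ-injective (toℚᵘ-≃ (≐-+ (fromℕ-≐ m) (fromℕ-≐ n)))

fromℕ-mono-≤ : ∀ {m n} → m ℕ.≤ n → fromℕ m ≤ fromℕ n
fromℕ-mono-≤ {m} {n} m≤n = ≐-mono-≤ (fromℕ-≐ m) (fromℕ-≐ n) (ℕ.*-monoˡ-≤ 1 m≤n)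

fromℕ-pos : ∀ {n} → 0 ℕ.< n → 0ℚ < fromℕ n
fromℕ-pos {n} 0<n = ≐-mono-< (fromℕ-≐ 0) (fromℕ-≐ n) (ℕ.*-monoˡ-< 1 0<n)

positive-≐ : ∀ y → 0ℚ < y → ∃[ a′ ] ∃[ b′ ] y ≐ suc a′ /1+ b′ × recip y ≐ suc b′ /1+ a′
positive-≐ (mkℚ +[1+ a′ ] b′ _) _ = a′ , b′ , by-toℚᵘ ℚᵘ.≃-refl , by-toℚᵘ ℚᵘ.≃-refl
positive-≐ (mkℚ (+ 0) _ _) (ℚ.*<* (ℤ.+<+ ()))
positive-≐ (mkℚ -[1+ _ ] _ _) (ℚ.*<* ())

module _ where
  open +-*-Solver

  1+[p-1]≡p : ∀ p → 1ℚ + (p - 1ℚ) ≡ p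
  1+[p-1]≡p = solve 1 (λ p → con 1ℚ :+ (p :- con 1ℚ) := p) refl

  [p+q]-q≡p : ∀ p q → p + q - q ≡ p
  [p+q]-q≡p = solve 2 (λ p q → p :+ q :- q := p) refl

  [p-q]*r≡p*r-q*r : ∀ p q r → (p - q) * r ≡ p * r - q * r
  [p-q]*r≡p*r-q*r = solve 3 (λ p q r → (p :- q) :* r := p :* r :- q :* r) refl

p<q⇒0<q-p : ∀ {p q} → p < q → 0ℚ < q - p
p<q⇒0<q-p {p} {q} p<q = subst (_< q - p) (ℚ.+-inverseʳ p) (ℚ.+-monoˡ-< (ℚ.- p) p<q)

p<q+r⇒p-r<q : ∀ {p q r} → p < q + r → p - r < q
p<q+r⇒p-r<q {p} {q} {r} p<q+r = subst (p - r <_) ([p+q]-q≡p q r) (ℚ.+-monoˡ-< (ℚ.- r) p<q+r)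

p-q-r≤p-q′ : ∀ {p q q′ r} → q′ ≤ q → 0ℚ ≤ r → p - q - r ≤ p - q′
p-q-r≤p-q′ {p} {q} {q′} {r} q′≤q 0≤r = ℚ.≤-trans
  (subst (p - q - r ≤_) (ℚ.+-identityʳ (p - q)) (ℚ.+-monoʳ-≤ (p - q) (ℚ.neg-antimono-≤ 0≤r)))
  (ℚ.+-monoʳ-≤ p (ℚ.neg-antimono-≤ q′≤q))

*-<-from-bounds : ∀ {t s v r c} → 0ℚ ≤ v → v ≤ r → 0ℚ < c → t ≤ s → s * r < c → t * v < c
*-<-from-bounds {t} {s} {v} {r} {c} 0≤v v≤r 0<c t≤s sr<c with t ℚ.≤? 0ℚ
... | yes t≤0 = ℚ.≤-<-trans
  (subst (t * v ≤_) (ℚ.*-zeroˡ v) (ℚ.*-monoʳ-≤-nonNeg v {{ℚ.nonNegative 0≤v}} t≤0)) 0<c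
... | no t≰0 = ℚ.≤-<-trans (ℚ.*-monoˡ-≤-nonNeg t {{ℚ.nonNegative (ℚ.<⇒≤ (ℚ.≰⇒> t≰0))}} v≤r)
                (ℚ.≤-<-trans (ℚ.*-monoʳ-≤-nonNeg r {{ℚ.nonNegative (ℚ.≤-trans 0≤v v≤r)}} t≤s) sr<c)

∣p∷ʳinside∣≡1+∣p∣ : ∀ {n} (p : Subset n) → ∣ p ∷ʳ inside ∣ ≡ suc ∣ p ∣
∣p∷ʳinside∣≡1+∣p∣ [] = refl
∣p∷ʳinside∣≡1+∣p∣ (inside ∷ p) = cong suc (∣p∷ʳinside∣≡1+∣p∣ p)
∣p∷ʳinside∣≡1+∣p∣ (outside ∷ p) = ∣p∷ʳinside∣≡1+∣p∣ p

All-∷ʳ : ∀ {A : Set} {P : A → Set} {n} {xs : Vec A n} {x} → All P xs → P x → All P (xs ∷ʳ x)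
All-∷ʳ [] px = px ∷ []
All-∷ʳ (py ∷ pys) px = py ∷ All-∷ʳ pys px

sumOver-⊥ : ∀ {n} f (xs : Vec Item n) → sumOver f xs ⊥ ≡ 0ℚ
sumOver-⊥ f [] = refl
sumOver-⊥ f (x ∷ xs) = sumOver-⊥ f xs

sumOver-∷ʳ : ∀ {n} f (xs : Vec Item n) x B → sumOver f (xs ∷ʳ x) (B ∷ʳ inside) ≡ sumOver f xs B + f x
sumOver-∷ʳ f [] x [] = trans (ℚ.+-identityʳ (f x)) (sym (ℚ.+-identityˡ (f x)))
sumOver-∷ʳ f (y ∷ xs) x (inside ∷ B) =
  trans (cong (λ z → f y + z) (sumOver-∷ʳ f xs x B)) (sym (ℚ.+-assoc (f y) _ (f x)))
sumOver-∷ʳ f (y ∷ xs) x (outside ∷ B) = sumOver-∷ʳ f xs x B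

sumOver-≐ : ∀ {n f d} {xs : Vec Item n} → All (λ x → f x ≐ 1 /1+ d) xs →
            ∀ B → sumOver f xs B ≐ ∣ B ∣ /1+ d
sumOver-≐ [] [] = ≐-resp (fromℕ-≐ 0) refl
sumOver-≐ (fx≐ ∷ fxs≐) (inside ∷ B) = ≐-+ fx≐ (sumOver-≐ fxs≐ B)
sumOver-≐ (_ ∷ fxs≐) (outside ∷ B) = sumOver-≐ fxs≐ B

sumOver-≤ : ∀ {n f k} {xs : Vec Item n} → All (λ x → f x ≤ fromℕ k) xs →
            ∀ B → sumOver f xs B ≤ fromℕ (∣ B ∣ ℕ.* k)
sumOver-≤ [] [] = ℚ.≤-refl
sumOver-≤ {k = k} (fx≤ ∷ fxs≤) (inside ∷ B) =
  subst (_ ≤_) (fromℕ-+ k (∣ B ∣ ℕ.* k)) (ℚ.+-mono-≤ fx≤ (sumOver-≤ fxs≤ B))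
sumOver-≤ (_ ∷ fxs≤) (outside ∷ B) = sumOver-≤ fxs≤ B

v-nonneg : ∀ {n} (xs : Vec Item n) B → 0ℚ ≤ v[ xs ] B
v-nonneg [] [] = ℚ.≤-refl
v-nonneg (x ∷ xs) (inside ∷ B) = ℚ.+-mono-≤ (value≥0 x) (v-nonneg xs B)
v-nonneg (x ∷ xs) (outside ∷ B) = v-nonneg xs B

Exceeding : ∀ {R} → OnlineAlg R → ℚ → Set
Exceeding A t = Σ ℕ λ n → Σ (Vec Item n) λ I → Σ ℚ λ alg → Σ ℚ λ opt →
  IsMaxPacking I (buffer A I) alg × IsMaxPacking I ⊤ opt × RatioExceeds alg opt t

Packable : ∀ {n} → Vec Item n → ℚ → Set
Packable xs y = Σ (Subset _) λ B → s[ xs ] B ≤ 1ℚ × y ≤ v[ xs ] B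

ratioExceeds : ∀ {n} {xs : Vec Item n} {S alg opt t y} →
  IsMaxPacking xs S alg → IsMaxPacking xs ⊤ opt → 0ℚ < y → Packable xs y →
  (∀ B → B ⊆ S → s[ xs ] B ≤ 1ℚ → t * v[ xs ] B < y) → RatioExceeds alg opt t
ratioExceeds {xs = xs} ((B , B⊆S , B-fits , refl) , _) (_ , opt-max) 0<y (C , C-fits , y≤vC) bounded
  with ℚ.≤-trans y≤vC (opt-max C ⊆⊤ C-fits) | 0ℚ ℚ.<? v[ xs ] B
... | y≤opt | yes 0<alg = inj₂ (0<alg , ℚ.<-≤-trans (bounded B B⊆S B-fits) y≤opt)
... | y≤opt | no alg≯0 = inj₁ (ℚ.≤-antisym (ℚ.≮⇒≥ alg≯0) (v-nonneg xs B) , ℚ.<-≤-trans 0<y y≤opt)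

data Optimum {n} (P : Subset n → Set) (f : Subset n → ℚ) : Set where
  infeasible : (∀ B → ¬ P B) → Optimum P f
  optimum    : ∀ B → P B → (∀ C → P C → f C ≤ f B) → Optimum P f

optimum? : ∀ {n} {P : Subset n → Set} → (∀ B → Dec (P B)) → (f : Subset n → ℚ) → Optimum P f
optimum? {zero} P? f with P? []
... | yes p = optimum [] p λ { [] _ → ℚ.≤-refl }
... | no ¬p = infeasible λ { [] → ¬p }
optimum? {suc n} P? f
  with optimum? (λ C → P? (inside ∷ C)) (λ C → f (inside ∷ C))
     | optimum? (λ C → P? (outside ∷ C)) (λ C → f (outside ∷ C))
... | infeasible ¬i | infeasible ¬o = infeasible λ { (inside ∷ C) → ¬i C ; (outside ∷ C) → ¬o C }
... | optimum Bi pi maxi | infeasible ¬o =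
  optimum (inside ∷ Bi) pi λ { (inside ∷ C) pC → maxi C pC ; (outside ∷ C) pC → ⊥-elim (¬o C pC) }
... | infeasible ¬i | optimum Bo po maxo =
  optimum (outside ∷ Bo) po λ { (inside ∷ C) pC → ⊥-elim (¬i C pC) ; (outside ∷ C) pC → maxo C pC }
... | optimum Bi pi maxi | optimum Bo po maxo with f (inside ∷ Bi) ℚ.≤? f (outside ∷ Bo)
...   | yes i≤o = optimum (outside ∷ Bo) po
          λ { (inside ∷ C) pC → ℚ.≤-trans (maxi C pC) i≤o ; (outside ∷ C) pC → maxo C pC }
...   | no i≰o = optimum (inside ∷ Bi) pi
          λ { (inside ∷ C) pC → maxi C pC
            ; (outside ∷ C) pC → ℚ.≤-trans (maxo C pC) (ℚ.<⇒≤ (ℚ.≰⇒> i≰o)) }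

maxPacking : ∀ {n} (xs : Vec Item n) S → Σ ℚ (IsMaxPacking xs S)
maxPacking xs S with optimum? (λ B → (B ⊆? S) ×-dec (s[ xs ] B ℚ.≤? 1ℚ)) v[ xs ]
... | infeasible ¬fits =
  ⊥-elim (¬fits ⊥ (⊥⊆ , subst (_≤ 1ℚ) (sym (sumOver-⊥ size xs)) (fromℕ-mono-≤ {0} {1} z≤n)))
... | optimum B (B⊆S , B-fits) max = v[ xs ] B , (B , B⊆S , B-fits , refl) , λ C C⊆S C-fits → max C (C⊆S , C-fits)

module Input (q′ V : ℕ) where

  q : ℕ
  q = suc q′

  large : Item
  large = record
    { size = 1ℚ ; value = fromℕ V
    ; size-pos = fromℕ-pos {1} (s≤s z≤n) ; size≤1 = ℚ.≤-refl ; value≥0 = fromℕ-mono-≤ z≤n }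

  small : ℕ → Item
  small i = record
    { size = 1/1+ q′ ; value = fromℕ i
    ; size-pos = ≐-mono-< (fromℕ-≐ 0) (1/1+-≐ q′) (s≤s z≤n)
    ; size≤1 = ≐-mono-≤ (1/1+-≐ q′) (fromℕ-≐ 1) (s≤s z≤n)
    ; value≥0 = fromℕ-mono-≤ z≤n }

  smalls : (k : ℕ) → Vec Item k
  smalls zero = []
  smalls (suc k) = smalls k ∷ʳ small k

  input : (k : ℕ) → Vec Item (suc k)
  input k = large ∷ smalls k

  smalls-size : ∀ k → All (λ x → size x ≐ 1 /1+ q′) (smalls k)
  smalls-size zero = []
  smalls-size (suc k) = All-∷ʳ (smalls-size k) (1/1+-≐ q′)

  smalls-value : ∀ k → All (λ x → value x ≤ fromℕ k) (smalls k)
  smalls-value zero = []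
  smalls-value (suc k) =
    All-∷ʳ (All.map (λ v≤k → ℚ.≤-trans v≤k k≤1+k) (smalls-value k)) k≤1+k
    where k≤1+k = fromℕ-mono-≤ (ℕ.n≤1+n k)

  smalls-value-≤ : ∀ {k c} B → ∣ B ∣ ℕ.≤ c → v[ smalls k ] B ≤ fromℕ (c ℕ.* k)
  smalls-value-≤ {k} B ∣B∣≤c =
    ℚ.≤-trans (sumOver-≤ (smalls-value k) B) (fromℕ-mono-≤ (ℕ.*-monoˡ-≤ k ∣B∣≤c))

  size-with-large : ∀ {k} C → s[ input k ] (inside ∷ C) ≐ (q ℕ.+ ∣ C ∣) /1+ q′
  size-with-large C = ≐-+ (≐-resp (fromℕ-≐ 1) (ℕ.*-comm 1 q)) (sumOver-≐ (smalls-size _) C)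

  large-alone : ∀ {k} C → s[ input k ] (inside ∷ C) ≤ 1ℚ → ∣ C ∣ ≡ 0
  large-alone C fits = ℕ.n≤0⇒n≡0 (ℕ.+-cancelˡ-≤ q ∣ C ∣ 0
    (subst (ℕ._≤ q ℕ.+ 0) (ℕ.*-identityʳ (q ℕ.+ ∣ C ∣))
      (≐-cancel-≤ (size-with-large C) (fromℕ-≐ 1) fits)))

  large-fits : ∀ k → Packable (input k) (fromℕ V)
  large-fits k = inside ∷ ⊥
    , subst (λ s → 1ℚ + s ≤ 1ℚ) (sym (sumOver-⊥ size (smalls k)))
        (ℚ.≤-reflexive (ℚ.+-identityʳ 1ℚ))
    , subst (λ v → fromℕ V ≤ fromℕ V + v) (sym (sumOver-⊥ value (smalls k)))
        (ℚ.≤-reflexive (sym (ℚ.+-identityʳ (fromℕ V))))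

  lastSmalls : ∀ p j → Σ (Subset (p ℕ.+ j)) λ C → ∣ C ∣ ≡ p × fromℕ (p ℕ.* j) ≤ v[ smalls (p ℕ.+ j) ] C
  lastSmalls zero j = ⊥ , ∣⊥∣≡0 j , v-nonneg (smalls j) ⊥
  lastSmalls (suc p) j with lastSmalls p j
  ... | C , ∣C∣≡p , pj≤vC = C ∷ʳ inside , trans (∣p∷ʳinside∣≡1+∣p∣ C) (cong suc ∣C∣≡p) , (begin
    fromℕ (suc p ℕ.* j)                                ≡⟨ cong fromℕ (ℕ.+-comm j (p ℕ.* j)) ⟩
    fromℕ (p ℕ.* j ℕ.+ j)                              ≡⟨ fromℕ-+ (p ℕ.* j) j ⟨
    fromℕ (p ℕ.* j) + fromℕ j                          ≤⟨ ℚ.+-mono-≤ pj≤vC (fromℕ-mono-≤ (ℕ.m≤n+m j p)) ⟩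
    v[ smalls (p ℕ.+ j) ] C + value (small (p ℕ.+ j))  ≡⟨ sumOver-∷ʳ value (smalls (p ℕ.+ j)) (small (p ℕ.+ j)) C ⟨
    v[ smalls (suc p ℕ.+ j) ] (C ∷ʳ inside)            ∎)
    where open ℚ.≤-Reasoning

  lastSmalls-fit : ∀ j → Packable (input (q ℕ.+ j)) (fromℕ (q ℕ.* j))
  lastSmalls-fit j = fit (lastSmalls q j)
    where
    fit : Σ (Subset (q ℕ.+ j)) (λ C → ∣ C ∣ ≡ q × fromℕ (q ℕ.* j) ≤ v[ smalls (q ℕ.+ j) ] C) →
          Packable (input (q ℕ.+ j)) (fromℕ (q ℕ.* j))
    fit (C , ∣C∣≡q , qj≤vC) = outside ∷ C
      , ≐-mono-≤ (sumOver-≐ (smalls-size (q ℕ.+ j)) C) (fromℕ-≐ 1)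
          (ℕ.≤-reflexive (trans (ℕ.*-identityʳ ∣ C ∣) (trans ∣C∣≡q (sym (ℕ.*-identityˡ q)))))
      , qj≤vC

module Adversary {R : ℚ} (A : OnlineAlg R) (a′ b′ E′ : ℕ) (R-1≐ : R - 1ℚ ≐ suc a′ /1+ b′) where
  open Parameters a′ b′ E′
  open Input q′ V hiding (q)

  buf : (k : ℕ) → Subset (suc k)
  buf k = buffer A (input k)

  R≐ : R ≐ (b ℕ.+ a) /1+ b′
  R≐ = subst (_≐ (b ℕ.+ a) /1+ b′) (1+[p-1]≡p R)
    (≐-+ (≐-resp (fromℕ-≐ 1) (ℕ.*-comm 1 b)) R-1≐)

  count-beside-large : ∀ {k C} → buf k ≡ inside ∷ C → ∣ C ∣ ℕ.≤ m
  count-beside-large {k} {C} eq = capacity ∣ C ∣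
    (≐-cancel-≤ (size-with-large C) R≐ (subst (λ B → s[ input k ] B ≤ R) eq (buffer-cap A (input k))))

  count-after-drop : ∀ {n C C′} → buf n ≡ inside ∷ C → buf (suc n) ≡ outside ∷ C′ → ∣ C′ ∣ ℕ.≤ P
  count-after-drop {n} {C} {C′} kept dropped = begin
    ∣ C′ ∣           ≤⟨ p⊆q⇒∣p∣≤∣q∣ (drop-∷-⊆ C′⊆) ⟩
    ∣ C ∷ʳ inside ∣  ≡⟨ ∣p∷ʳinside∣≡1+∣p∣ C ⟩
    suc ∣ C ∣        ≤⟨ s≤s (count-beside-large kept) ⟩
    P                ∎
    where
    open ℕ.≤-Reasoning
    C′⊆ : outside ∷ C′ ⊆ inside ∷ (C ∷ʳ inside)
    C′⊆ = subst₂ _⊆_ dropped (cong (_∷ʳ inside) kept) (buffer-⊆ A (input n) (small n))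

  data Fate (n : ℕ) : Set where
    kept    : ∀ C → buf n ≡ inside ∷ C → Fate n
    dropped : ∀ {k} C → k ℕ.≤ n → buf k ≡ outside ∷ C → ∣ C ∣ ℕ.≤ P → Fate n

  fate : ∀ n → Fate n
  fate zero = start (buf 0) refl
    where
    start : ∀ B → buf 0 ≡ B → Fate 0
    start (inside ∷ C) eq = kept C eq
    start (outside ∷ []) eq = dropped [] z≤n eq z≤n
  fate (suc n) = next (fate n) (buf (suc n)) refl
    where
    next : Fate n → ∀ B → buf (suc n) ≡ B → Fate (suc n)
    next (dropped C k≤n eq ∣C∣≤P) _ _ = dropped C (ℕ.m≤n⇒m≤1+n k≤n) eq ∣C∣≤P
    next (kept C eq) (inside ∷ C′) eq′ = kept C′ eq′
    next (kept C eq) (outside ∷ C′) eq′ = dropped C′ ℕ.≤-refl eq′ (count-after-drop eq eq′)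

  count-⊆-tail : ∀ {k β C B} → buf k ≡ β ∷ C → outside ∷ B ⊆ buf k → ∣ B ∣ ℕ.≤ ∣ C ∣
  count-⊆-tail eq B⊆ = p⊆q⇒∣p∣≤∣q∣ (drop-∷-⊆ (subst (_ ⊆_) eq B⊆))

  alg-after-drop : ∀ {k C B} → buf k ≡ outside ∷ C → ∣ C ∣ ℕ.≤ P → B ⊆ buf k →
                   v[ input k ] B ≤ fromℕ (P ℕ.* k)
  alg-after-drop {B = inside ∷ B} eq _ B⊆ with subst (inside ∷ B ⊆_) eq B⊆ here
  ... | ()
  alg-after-drop {B = outside ∷ B} eq ∣C∣≤P B⊆ =
    smalls-value-≤ B (ℕ.≤-trans (count-⊆-tail eq B⊆) ∣C∣≤P)

  alg-while-kept : ∀ {n C B} → buf n ≡ inside ∷ C → B ⊆ buf n → s[ input n ] B ≤ 1ℚ →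
                   v[ input n ] B ≤ fromℕ V ⊎ v[ input n ] B ≤ fromℕ (P ℕ.* n)
  alg-while-kept {n} {B = inside ∷ B} _ _ fits = inj₁ (begin
    fromℕ V + v[ smalls n ] B  ≤⟨ ℚ.+-monoʳ-≤ (fromℕ V) (smalls-value-≤ B (ℕ.≤-reflexive (large-alone B fits))) ⟩
    fromℕ V + fromℕ 0          ≡⟨ ℚ.+-identityʳ (fromℕ V) ⟩
    fromℕ V                    ∎)
    where open ℚ.≤-Reasoning
  alg-while-kept {B = outside ∷ B} eq B⊆ _ =
    inj₂ (smalls-value-≤ B (ℕ.≤-trans (count-⊆-tail eq B⊆) (ℕ.≤-trans (count-beside-large eq) (ℕ.n≤1+n m))))

  module _ {t z : ℚ} (z≐ : z ≐ b /1+ a′) (t≤ : t ≤ z - 1/1+ E′) where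

    OptBeats⇒t*v<y : ∀ {x y v} → OptBeats x y → 0 ℕ.< y → 0ℚ ≤ v → v ≤ fromℕ x → t * v < fromℕ y
    OptBeats⇒t*v<y {x} {y} beats 0<y 0≤v v≤x = *-<-from-bounds 0≤v v≤x (fromℕ-pos 0<y) t≤
      (subst (_< fromℕ y) (sym ([p-q]*r≡p*r-q*r z (1/1+ E′) (fromℕ x))) (p<q+r⇒p-r<q cross))
      where
      cross : z * fromℕ x < fromℕ y + 1/1+ E′ * fromℕ x
      cross = ≐-mono-< (≐-*-fromℕ x z≐)
        (≐-+ (≐-resp {n = E ℕ.* y} (fromℕ-≐ y) (lhs y E′)) (≐-*-fromℕ x (1/1+-≐ E′)))
        (subst₂ ℕ._<_ (rearrangeˡ b E x) (rearrangeʳ a E x y) beats)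
        where
        lhs : ∀ y E′ → y ℕ.* suc E′ ≡ suc E′ ℕ.* y ℕ.* 1
        lhs = solve-∀
        rearrangeˡ : ∀ b E x → b ℕ.* E ℕ.* x ≡ b ℕ.* x ℕ.* E
        rearrangeˡ = solve-∀
        rearrangeʳ : ∀ a E x y → a ℕ.* (E ℕ.* y ℕ.+ x) ≡ (E ℕ.* y ℕ.+ 1 ℕ.* x) ℕ.* a
        rearrangeʳ = solve-∀

    exceeding-at : ∀ {k} y → 0 ℕ.< y → Packable (input k) (fromℕ y) →
      (∀ {B} → B ⊆ buf k → s[ input k ] B ≤ 1ℚ → ∃[ x ] OptBeats x y × v[ input k ] B ≤ fromℕ x) →
      Exceeding A t
    exceeding-at {k} y 0<y fits bounded = pack (maxPacking (input k) (buf k)) (maxPacking (input k) ⊤)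
      where
      t*v<y : ∀ B → B ⊆ buf k → s[ input k ] B ≤ 1ℚ → t * v[ input k ] B < fromℕ y
      t*v<y B B⊆ fits = via (bounded B⊆ fits)
        where
        via : ∃[ x ] OptBeats x y × v[ input k ] B ≤ fromℕ x → t * v[ input k ] B < fromℕ y
        via (_ , beats , v≤x) = OptBeats⇒t*v<y beats 0<y (v-nonneg (input k) B) v≤x
      pack : Σ ℚ (IsMaxPacking (input k) (buf k)) → Σ ℚ (IsMaxPacking (input k) ⊤) → Exceeding A t
      pack (alg , isAlg) (opt , isOpt) = suc k , input k , alg , opt , isAlg , isOpt ,
        ratioExceeds {xs = input k} {t = t} isAlg isOpt (fromℕ-pos 0<y) fits t*v<y

    exceeding-kept : ∀ {j C} → J ℕ.≤ j → b ℕ.* V ℕ.< j → buf (q ℕ.+ j) ≡ inside ∷ C → Exceeding A t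
    exceeding-kept {j} J≤j bV<j eq =
      exceeding-at (q ℕ.* j) (0<q* (J≤⇒0< J≤j)) (lastSmalls-fit j) λ B⊆ fits →
        [ (λ v≤V → V , optBeats-large bV<j , v≤V)
        , (λ v≤Pk → P ℕ.* (q ℕ.+ j) , optBeats-late J≤j , v≤Pk)
        ]′ (alg-while-kept eq B⊆ fits)

    exceeding-early-drop : ∀ {k C} → buf k ≡ outside ∷ C → ∣ C ∣ ℕ.≤ P → k ℕ.≤ K → Exceeding A t
    exceeding-early-drop {k} eq ∣C∣≤P k≤K =
      exceeding-at V 0<V (large-fits k) λ B⊆ _ →
        P ℕ.* k , optBeats-early {k} k≤K , alg-after-drop eq ∣C∣≤P B⊆

    exceeding-late-drop : ∀ {j C} → buf (q ℕ.+ j) ≡ outside ∷ C → ∣ C ∣ ℕ.≤ P → J ℕ.≤ j →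
                          Exceeding A t
    exceeding-late-drop {j} eq ∣C∣≤P J≤j =
      exceeding-at (q ℕ.* j) (0<q* (J≤⇒0< J≤j)) (lastSmalls-fit j) λ B⊆ _ →
        P ℕ.* (q ℕ.+ j) , optBeats-late {j} J≤j , alg-after-drop eq ∣C∣≤P B⊆

    exceeding : Exceeding A t
    exceeding = byFate (fate (q ℕ.+ jN))
      where
      byLate : ∀ {k C} → buf k ≡ outside ∷ C → ∣ C ∣ ℕ.≤ P →
               ∃[ j ] J ℕ.≤ j × q ℕ.+ j ≡ k → Exceeding A t
      byLate eq ∣C∣≤P (_ , J≤j , refl) = exceeding-late-drop eq ∣C∣≤P J≤j
      byDrop : ∀ {k C} → buf k ≡ outside ∷ C → ∣ C ∣ ℕ.≤ P → Dec (k ℕ.≤ K) → Exceeding A t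
      byDrop eq ∣C∣≤P (yes k≤K) = exceeding-early-drop eq ∣C∣≤P k≤K
      byDrop eq ∣C∣≤P (no k≰K) = byLate eq ∣C∣≤P (beyond-K (ℕ.≰⇒> k≰K))
      byFate : Fate (q ℕ.+ jN) → Exceeding A t
      byFate (kept _ eq) = exceeding-kept J≤jN bV<jN eq
      byFate (dropped {k} _ _ eq ∣C∣≤P) = byDrop eq ∣C∣≤P (k ℕ.≤? K)

theorem6 : (R ε : ℚ) → 1ℚ < R → R ≤ (+ 3) / 2 → 0ℚ < ε →
    (A : OnlineAlg R) → (δ : ℚ) → 0ℚ < δ →
    Σ ℕ λ n → Σ (Vec Item n) λ I → Σ ℚ λ alg → Σ ℚ λ opt →
    IsMaxPacking I (buffer A I) alg × IsMaxPacking I ⊤ opt ×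
    RatioExceeds alg opt (recip (R - 1ℚ) - ε - δ)
theorem6 R ε 1<R _ 0<ε A δ 0<δ with positive-≐ (R - 1ℚ) (p<q⇒0<q-p 1<R) | positive-≐ ε 0<ε
... | a′ , b′ , R-1≐ , 1/[R-1]≐ | e′ , E′ , ε≐ , _ =
  Adversary.exceeding A a′ b′ E′ R-1≐ 1/[R-1]≐ (p-q-r≤p-q′ {recip (R - 1ℚ)} 1/E≤ε (ℚ.<⇒≤ 0<δ))
  where
  1/E≤ε : 1/1+ E′ ≤ ε
  1/E≤ε = ≐-mono-≤ (1/1+-≐ E′) ε≐ (ℕ.*-monoˡ-≤ (suc E′) (s≤s (z≤n {e′})))
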